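{- Let $\Gamma$ be a connected graph and let $\sigma=(v_1,\dots,v_n)$ be an ordering of $V_\Gamma$ which is the left-to-right leaf sequence of some $\Gamma$-admissible planar binary tree. If $1\le i\le n-1$ and $\{v_i,v_{i+1}\}\in E_\Gamma$, then $\sigma_i=(v_1,\dots,v_{i-1},\{v_i,v_{i+1}\},v_{i+2},\dots,v_n)$ is the left-to-right leaf sequence of some $(\Gamma/\{v_i,v_{i+1}\})$-admissible planar binary tree.
   Context: Graphs are finite, simple, undirected. A tube of $\Gamma$ is a nonempty $G\subseteq V_\Gamma$ with $\Gamma|_G$ connected. $\Gamma/G$ is obtained by contracting the tube $G$ to a single vertex $\{G\}$ (vertices outside $G$ keep their adjacencies; $v\notin G$ is adjacent to $\{G\}$ iff adjacent to some vertex of $G$). A $\Gamma$-admissible planar binary tree is a planar rooted tree whose internal vertices each have exactly two children, with leaves labelled bijectively by $V_\Gamma$, such that for every vertex of the tree the set of leaf labels below it is a tube of $\Gamma$. -}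

module Defs where

open import Data.Bool using (Bool; true; false; not; T; _∨_)
open import Data.Unit using (⊤; tt)
open import Data.Empty using (⊥)
open import Data.Product using (Σ; ∃; _×_; _,_; proj₁)
open import Data.Sum using (_⊎_; inj₁; inj₂)
open import Data.Maybe using (Maybe; just; nothing)
open import Data.List using (List; []; _∷_; _++_; map)
open import Data.List.Membership.Propositional using (_∈_)
open import Data.List.Relation.Unary.Unique.Propositional using (Unique)
open import Relation.Nullary using (¬_; Dec; yes; no; does)
open import Relation.Binary.PropositionalEquality using (_≡_)
open import Relation.Binary.Definitions using (DecidableEquality)

-- The vertex type carries decidable
-- equality (needed to define contraction constructively).  Finiteness
-- of the vertex set is not built in; in the statement it follows from
-- the hypothesis that some tree has its leaves labelled bijectively by
-- the vertices (a duplicate-free list containing every vertex).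

record Graph : Set₁ where
  field
    V      : Set
    _≟V_   : DecidableEquality V
    E      : V → V → Set
    E-sym  : ∀ {u v} → E u v → E v u
    E-irr  : ∀ {v} → ¬ E v v

open Graph public

module _ (Γ : Graph) where
  data Walk (P : V Γ → Set) : V Γ → V Γ → Set where
    here : ∀ {v} → P v → Walk P v v
    step : ∀ {u w v} → P u → E Γ u w → Walk P w v → Walk P u v

  Connected : Set
  Connected = ∀ u v → Walk (λ _ → ⊤) u v

  NonEmpty : List (V Γ) → Set
  NonEmpty []      = ⊥
  NonEmpty (_ ∷ _) = ⊤

  Tube : List (V Γ) → Set
  Tube G = NonEmpty G × (∀ u v → u ∈ G → v ∈ G → Walk (_∈ G) u v)

data PTree (A : Set) : Set where
  leaf : A → PTree A
  node : PTree A → PTree A → PTree A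

leaves : ∀ {A} → PTree A → List A
leaves (leaf a)   = a ∷ []
leaves (node l r) = leaves l ++ leaves r

BijLabelled : (Γ : Graph) → PTree (V Γ) → Set
BijLabelled Γ t = Unique (leaves t) × (∀ v → v ∈ leaves t)

Admissible : (Γ : Graph) → PTree (V Γ) → Set
Admissible Γ (leaf v)   = Tube Γ (v ∷ [])
Admissible Γ (node l r) = Tube Γ (leaves l ++ leaves r) × Admissible Γ l × Admissible Γ r

IsAdmissibleLeafSeq : (Γ : Graph) → List (V Γ) → Set
IsAdmissibleLeafSeq Γ σ =
  ∃ λ (t : PTree (V Γ)) → Admissible Γ t × BijLabelled Γ t × leaves t ≡ σ

-- Contraction Γ / G of a vertex set G (a list).
-- Vertices: the vertices of Γ not in G (inj₁) plus one new vertex {G} (inj₂).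

module _ (Γ : Graph) where
  memb : V Γ → List (V Γ) → Bool
  memb v []      = false
  memb v (g ∷ G) = does (_≟V_ Γ v g) ∨ memb v G

  CV : List (V Γ) → Set
  CV G = Σ (V Γ) (λ v → T (not (memb v G))) ⊎ ⊤

  CE : (G : List (V Γ)) → CV G → CV G → Set
  CE G (inj₁ (u , _)) (inj₁ (v , _)) = E Γ u v
  CE G (inj₁ (u , _)) (inj₂ _)       = ∃ λ g → g ∈ G × E Γ u g
  CE G (inj₂ _)       (inj₁ (v , _)) = ∃ λ g → g ∈ G × E Γ g v
  CE G (inj₂ _)       (inj₂ _)       = ⊥

  private
    T-irr : ∀ b (p q : T b) → p ≡ q
    T-irr true  tt tt = Relation.Binary.PropositionalEquality.refl
    T-irr false () _

    CE-sym : ∀ G {x y} → CE G x y → CE G y x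
    CE-sym G {inj₁ _} {inj₁ _} e = E-sym Γ e
    CE-sym G {inj₁ _} {inj₂ _} (g , m , e) = g , m , E-sym Γ e
    CE-sym G {inj₂ _} {inj₁ _} (g , m , e) = g , m , E-sym Γ e
    CE-sym G {inj₂ _} {inj₂ _} ()

    CE-irr : ∀ G {x} → ¬ CE G x x
    CE-irr G {inj₁ _} e = E-irr Γ e
    CE-irr G {inj₂ _} ()

    CV-dec : ∀ G → DecidableEquality (CV G)
    CV-dec G (inj₁ (u , p)) (inj₁ (v , q)) with _≟V_ Γ u v
    ... | yes Relation.Binary.PropositionalEquality.refl
          with T-irr _ p q
    ...   | Relation.Binary.PropositionalEquality.refl = yes Relation.Binary.PropositionalEquality.refl
    CV-dec G (inj₁ (u , p)) (inj₁ (v , q)) | no u≢v =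
      no λ { Relation.Binary.PropositionalEquality.refl → u≢v Relation.Binary.PropositionalEquality.refl }
    CV-dec G (inj₁ _) (inj₂ _) = no λ ()
    CV-dec G (inj₂ _) (inj₁ _) = no λ ()
    CV-dec G (inj₂ tt) (inj₂ tt) = yes Relation.Binary.PropositionalEquality.refl

  infixl 5 _/_
  _/_ : List (V Γ) → Graph
  _/_ G = record
    { V = CV G ; _≟V_ = CV-dec G ; E = CE G
    ; E-sym = λ {u} {v} → CE-sym G {u} {v} ; E-irr = λ {v} → CE-irr G {v} }

  orig : ∀ G → CV G → Maybe (V Γ)
  orig G (inj₁ (v , _)) = just v
  orig G (inj₂ _)       = nothing

-- Contracting the edge {a, b} maps Γ weakly homomorphically onto Γ/{a, b},
-- and the image of a tube under a weak homomorphism is a tube.  So it suffices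
-- to turn the given tree into a tree with leaf sequence xs ++ b ∷ ys whose
-- nodes, after identifying a with b, have the same vertex sets as tubes of Γ.
-- Walk down to the node where a and b separate: a is the last leaf of its left
-- subtree l and b the first leaf of its right subtree r.  Delete the leaf a and
-- hang r in its place; every node X on the right spine of l becomes
-- (X ∖ {a}) ∪ r, whose image is that of the tube X ∪ r (joined by the edge ab).
module Submission where

open import Defs
open import Data.Bool using (true; false; not; T)
open import Data.Bool.Properties using (T-irrelevant)
open import Data.Empty using (⊥-elim)
open import Data.List using (List; []; _∷_; _++_; map)
open import Data.List.Properties using (++-assoc; ++-conicalʳ; map-++; ∷-injective)
open import Data.List.Membership.Propositional using (_∈_; _∉_)
open import Data.List.Membership.Propositional.Properties using (∈-++⁺ˡ; ∈-++⁺ʳ; ∈-++⁻; ∈-map⁺; ∈-map⁻)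
open import Data.List.Relation.Binary.Permutation.Propositional using (_↭_; ↭-sym; ↭⇒↭ₛ)
open import Data.List.Relation.Binary.Permutation.Propositional.Properties using (shift; shifts)
import Data.List.Relation.Binary.Permutation.Setoid.Properties as Permutationₛ
open import Data.List.Relation.Binary.Subset.Propositional using (_⊆_)
open import Data.List.Relation.Binary.Subset.Propositional.Properties using (++⁺ʳ; ∷⁺ʳ; xs⊆x∷xs)
open import Data.List.Relation.Unary.All as All using (All; []; _∷_)
import Data.List.Relation.Unary.All.Properties as Allₚ
open import Data.List.Relation.Unary.AllPairs using (_∷_)
open import Data.List.Relation.Unary.Any using (here; there)
open import Data.List.Relation.Unary.Unique.Propositional using (Unique)
import Data.List.Relation.Unary.Unique.Propositional.Properties as Unique
open import Data.Maybe using (just; nothing)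
open import Data.Maybe.Properties using (just-injective)
open import Data.Product using (∃; Σ; _×_; _,_; proj₁; proj₂)
open import Data.Sum using (_⊎_; inj₁; inj₂)
open import Data.Unit using (tt)
open import Relation.Binary.Definitions using (_Respects_)
open import Relation.Binary.PropositionalEquality
  using (_≡_; _≢_; refl; sym; trans; cong; cong₂; subst; setoid; module ≡-Reasoning)
open import Relation.Nullary using (¬_; yes; no)
open import Relation.Nullary.Decidable using (T?)

Unique-resp-↭ : ∀ {A : Set} → Unique {A = A} Respects _↭_
Unique-resp-↭ {A} p = Permutationₛ.Unique-resp-↭ (setoid A) (↭⇒↭ₛ p)

module _ {A : Set} where

  split-++≡++∷ : ∀ (ps qs xs : List A) {x : A} zs → ps ++ qs ≡ xs ++ x ∷ zs →
    (∃ λ k → xs ≡ ps ++ k × qs ≡ k ++ x ∷ zs) ⊎ (∃ λ k → ps ≡ xs ++ x ∷ k × zs ≡ k ++ qs)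
  split-++≡++∷ []       qs xs       zs e = inj₁ (xs , refl , e)
  split-++≡++∷ (p ∷ ps) qs []       zs e with ∷-injective e
  ... | refl , e′ = inj₂ (ps , refl , sym e′)
  split-++≡++∷ (p ∷ ps) qs (y ∷ xs) zs e with ∷-injective e
  ... | refl , e′ with split-++≡++∷ ps qs xs zs e′
  ...   | inj₁ (k , xs≡ , qs≡) = inj₁ (k , cong (p ∷_) xs≡ , qs≡)
  ...   | inj₂ (k , ps≡ , zs≡) = inj₂ (k , cong (p ∷_) ps≡ , zs≡)

  map-merge-⊆ : ∀ {B : Set} (f : A → B) {a b} p q → f a ≡ f b →
    map f (p ++ a ∷ b ∷ q) ⊆ map f (p ++ b ∷ q)
  map-merge-⊆ f {a} {b} p q fa≡fb
    rewrite map-++ f p (a ∷ b ∷ q) | map-++ f p (b ∷ q) | fa≡fb =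
      ++⁺ʳ (map f p) λ { (here e) → here e ; (there m) → m }

  map-merge-⊇ : ∀ {B : Set} (f : A → B) {a b} p q → f a ≡ f b →
    map f (p ++ b ∷ q) ⊆ map f (p ++ a ∷ b ∷ q)
  map-merge-⊇ f {a} {b} p q fa≡fb
    rewrite map-++ f p (a ∷ b ∷ q) | map-++ f p (b ∷ q) | fa≡fb =
      ++⁺ʳ (map f p) (∷⁺ʳ (f b) (xs⊆x∷xs (map f q) (f b)))

  Unique-++-∷-∷ : ∀ xs ys {a b : A} → Unique (xs ++ a ∷ b ∷ ys) →
                  All (_∉ a ∷ b ∷ []) (xs ++ ys) × Unique (xs ++ ys)
  Unique-++-∷-∷ xs ys uq with Unique-resp-↭ (shifts xs (_ ∷ _ ∷ [])) uq
  ... | a≢ ∷ b≢ ∷ uq′ = All.tabulate avoid , uq′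
    where
      avoid : ∀ {z} → z ∈ xs ++ ys → z ∉ _ ∷ _ ∷ []
      avoid z∈ (here refl)         = All.lookup a≢ (there z∈) refl
      avoid z∈ (there (here refl)) = All.lookup b≢ z∈ refl

  Unique-just-nothing : ∀ xs ys → Unique (xs ++ ys) →
                        Unique (map just xs ++ nothing ∷ map just ys)
  Unique-just-nothing xs ys uq =
    Unique-resp-↭ (↭-sym (shift nothing (map just xs) (map just ys)))
      (subst (λ js → Unique (nothing ∷ js)) (map-++ just xs ys)
        (Allₚ.map⁺ (All.universal (λ _ ()) (xs ++ ys))
         ∷ Unique.map⁺ {f = just} (just-injective {A = A}) uq))

module _ (Γ : Graph) where

  Walk-mono : ∀ {P Q : V Γ → Set} {u v} → (∀ {x} → P x → Q x) →
              Walk Γ P u v → Walk Γ Q u v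
  Walk-mono P⇒Q (here p)     = here (P⇒Q p)
  Walk-mono P⇒Q (step p e w) = step (P⇒Q p) e (Walk-mono P⇒Q w)

  Walk-++ : ∀ {P : V Γ → Set} {u w v} → Walk Γ P u w → Walk Γ P w v → Walk Γ P u v
  Walk-++ (here _)      w₂ = w₂
  Walk-++ (step p e w₁) w₂ = step p e (Walk-++ w₁ w₂)

  Tube-resp-⊆ : ∀ {S R} → Tube Γ S → S ⊆ R → R ⊆ S → Tube Γ R
  Tube-resp-⊆ {[]}    (() , _)
  Tube-resp-⊆ {_ ∷ _} {[]} _ S⊆R _ with S⊆R (here refl)
  ... | ()
  Tube-resp-⊆ {_ ∷ _} {_ ∷ _} (_ , walk) S⊆R R⊆S =
    tt , λ u v u∈R v∈R → Walk-mono S⊆R (walk u v (R⊆S u∈R) (R⊆S v∈R))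

  Tube-++ : ∀ {S R u w} → Tube Γ S → Tube Γ R → u ∈ S → w ∈ R → E Γ u w →
            Tube Γ (S ++ R)
  Tube-++ {[]} (() , _)
  Tube-++ {s ∷ S} {R} {u} {w} (_ , walkS) (_ , walkR) u∈S w∈R uw = tt , walk
    where
      inS : ∀ {x y} → Walk Γ (_∈ s ∷ S) x y → Walk Γ (_∈ (s ∷ S) ++ R) x y
      inS = Walk-mono ∈-++⁺ˡ
      inR : ∀ {x y} → Walk Γ (_∈ R) x y → Walk Γ (_∈ (s ∷ S) ++ R) x y
      inR = Walk-mono (∈-++⁺ʳ (s ∷ S))
      walk : ∀ x y → x ∈ (s ∷ S) ++ R → y ∈ (s ∷ S) ++ R → Walk Γ (_∈ (s ∷ S) ++ R) x y
      walk x y x∈ y∈ with ∈-++⁻ (s ∷ S) x∈ | ∈-++⁻ (s ∷ S) y∈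
      ... | inj₁ x∈S | inj₁ y∈S = inS (walkS x y x∈S y∈S)
      ... | inj₁ x∈S | inj₂ y∈R =
        Walk-++ (inS (walkS x u x∈S u∈S)) (step (∈-++⁺ˡ u∈S) uw (inR (walkR w y w∈R y∈R)))
      ... | inj₂ x∈R | inj₁ y∈S =
        Walk-++ (inR (walkR x w x∈R w∈R))
                (step (∈-++⁺ʳ (s ∷ S) w∈R) (E-sym Γ uw) (inS (walkS u y u∈S y∈S)))
      ... | inj₂ x∈R | inj₂ y∈R = inR (walkR x y x∈R y∈R)

  Tube-join : ∀ {p q a b} → Tube Γ (p ++ a ∷ []) → Tube Γ (b ∷ q) → E Γ a b →
              Tube Γ (p ++ a ∷ b ∷ q)
  Tube-join {p} {q} {a} {b} tl tr ab =
    subst (Tube Γ) (++-assoc p (a ∷ []) (b ∷ q))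
      (Tube-++ tl tr (∈-++⁺ʳ p (here refl)) (here refl) ab)

mapPTree : ∀ {A B : Set} → (A → B) → PTree A → PTree B
mapPTree f (leaf x)   = leaf (f x)
mapPTree f (node l r) = node (mapPTree f l) (mapPTree f r)

leaves-mapPTree : ∀ {A B : Set} (f : A → B) t → leaves (mapPTree f t) ≡ map f (leaves t)
leaves-mapPTree f (leaf x)   = refl
leaves-mapPTree f (node l r) =
  trans (cong₂ _++_ (leaves-mapPTree f l) (leaves-mapPTree f r))
        (sym (map-++ f (leaves l) (leaves r)))

leaves≢[] : ∀ {A : Set} (t : PTree A) → ¬ leaves t ≡ []
leaves≢[] (leaf _)   ()
leaves≢[] (node l r) e = leaves≢[] r (++-conicalʳ (leaves l) (leaves r) e)

Admissible⇒Tube : ∀ Γ t → Admissible Γ t → Tube Γ (leaves t)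
Admissible⇒Tube Γ (leaf _)   tube       = tube
Admissible⇒Tube Γ (node _ _) (tube , _) = tube

module _ (Γ : Graph) {σ : List (V Γ)} where

  AdmissibleLeafSeq⇒Unique : IsAdmissibleLeafSeq Γ σ → Unique σ
  AdmissibleLeafSeq⇒Unique (_ , _ , (uq , _) , leaves-t) = subst Unique leaves-t uq

  AdmissibleLeafSeq⇒covers : IsAdmissibleLeafSeq Γ σ → ∀ v → v ∈ σ
  AdmissibleLeafSeq⇒covers (_ , _ , (_ , covers) , leaves-t) v = subst (v ∈_) leaves-t (covers v)

  AdmissibleLeafSeq-intro : ∀ t → Admissible Γ t → Unique σ → (∀ v → v ∈ σ) → leaves t ≡ σ →
                            IsAdmissibleLeafSeq Γ σ
  AdmissibleLeafSeq-intro t adm uq covers leaves-t =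
    t , adm , (subst Unique (sym leaves-t) uq , λ v → subst (v ∈_) (sym leaves-t) (covers v)) , leaves-t

WeakHomomorphism : (Γ Δ : Graph) → (V Γ → V Δ) → Set
WeakHomomorphism Γ Δ f = ∀ {u w} → E Γ u w → f u ≡ f w ⊎ E Δ (f u) (f w)

module WeakHomomorphism {Γ Δ : Graph} {f : V Γ → V Δ} (hom : WeakHomomorphism Γ Δ f) where

  Walk-map : ∀ {P : V Γ → Set} {Q : V Δ → Set} {u v} → (∀ {x} → P x → Q (f x)) →
             Walk Γ P u v → Walk Δ Q (f u) (f v)
  Walk-map P⇒Q (here p) = here (P⇒Q p)
  Walk-map P⇒Q (step p e w) with hom e
  ... | inj₁ fu≡fw rewrite fu≡fw = Walk-map P⇒Q w
  ... | inj₂ e′ = step (P⇒Q p) e′ (Walk-map P⇒Q w)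

  Tube-map : ∀ {S} → Tube Γ S → Tube Δ (map f S)
  Tube-map {[]}    (() , _)
  Tube-map {s ∷ S} (_ , walk) = tt , walk′
    where
      walk′ : ∀ u v → u ∈ map f (s ∷ S) → v ∈ map f (s ∷ S) → Walk Δ (_∈ map f (s ∷ S)) u v
      walk′ _ _ u∈ v∈ with ∈-map⁻ f u∈ | ∈-map⁻ f v∈
      ... | x , x∈ , refl | y , y∈ , refl = Walk-map (∈-map⁺ f) (walk x y x∈ y∈)

  Admissible-map : ∀ t → Admissible Γ t → Admissible Δ (mapPTree f t)
  Admissible-map (leaf _) tube = Tube-map tube
  Admissible-map (node l r) (tube , adm-l , adm-r) =
    subst (Tube Δ) (sym (leaves-mapPTree f (node l r))) (Tube-map tube)
    , Admissible-map l adm-l , Admissible-map r adm-r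

  module _ {a b : V Γ} (ab : E Γ a b) (fa≡fb : f a ≡ f b) where

    Tube-merge : ∀ t p q → leaves t ≡ p ++ b ∷ q → Tube Γ (p ++ a ∷ b ∷ q) →
                 Tube Δ (leaves (mapPTree f t))
    Tube-merge t p q leaves-t tube =
      subst (Tube Δ) (sym (trans (leaves-mapPTree f t) (cong (map f) leaves-t)))
        (Tube-resp-⊆ Δ (Tube-map tube) (map-merge-⊆ f p q fa≡fb) (map-merge-⊇ f p q fa≡fb))

    MergedTree : List (V Γ) → List (V Γ) → Set
    MergedTree p q = ∃ λ t → leaves t ≡ p ++ b ∷ q × Admissible Δ (mapPTree f t)

    merge-straddling-leaves : ∀ l r p q → Admissible Γ l → Admissible Γ r →
      leaves l ≡ p ++ a ∷ [] → leaves r ≡ b ∷ q → MergedTree p q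
    merge-straddling-leaves (leaf _) r [] q _ adm-r _ leaves-r =
      r , leaves-r , Admissible-map r adm-r
    merge-straddling-leaves (leaf _) r (_ ∷ [])    q _ _ () _
    merge-straddling-leaves (leaf _) r (_ ∷ _ ∷ _) q _ _ () _
    merge-straddling-leaves (node l₁ l₂) r p q (tube , adm₁ , adm₂) adm-r leaves-l leaves-r
      with split-++≡++∷ (leaves l₁) (leaves l₂) p [] leaves-l
    ... | inj₂ (k , _ , []≡k++l₂) = ⊥-elim (leaves≢[] l₂ (++-conicalʳ k (leaves l₂) (sym []≡k++l₂)))
    ... | inj₁ (k , refl , leaves-l₂)
      with merge-straddling-leaves l₂ r k q adm₂ adm-r leaves-l₂ leaves-r
    ...   | t₂ , leaves-t₂ , adm-t₂ =
      node l₁ t₂ , leaves-node ,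
      (Tube-merge (node l₁ t₂) (leaves l₁ ++ k) q leaves-node
         (Tube-join Γ (subst (Tube Γ) leaves-l tube)
                      (subst (Tube Γ) leaves-r (Admissible⇒Tube Γ r adm-r)) ab)
      , Admissible-map l₁ adm₁ , adm-t₂)
      where
        leaves-node : leaves l₁ ++ leaves t₂ ≡ (leaves l₁ ++ k) ++ b ∷ q
        leaves-node = trans (cong (leaves l₁ ++_) leaves-t₂) (sym (++-assoc (leaves l₁) k (b ∷ q)))

    merge-adjacent-leaves : ∀ t xs ys → Admissible Γ t → leaves t ≡ xs ++ a ∷ b ∷ ys →
                            MergedTree xs ys
    merge-adjacent-leaves (leaf _) []           ys _ ()
    merge-adjacent-leaves (leaf _) (_ ∷ [])     ys _ ()
    merge-adjacent-leaves (leaf _) (_ ∷ _ ∷ _) ys _ ()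
    merge-adjacent-leaves (node l r) xs ys (tube , adm-l , adm-r) leaves-t
      with split-++≡++∷ (leaves l) (leaves r) xs (b ∷ ys) leaves-t
    ... | inj₁ (k , refl , leaves-r) with merge-adjacent-leaves r k ys adm-r leaves-r
    ...   | r′ , leaves-r′ , adm-r′ =
      node l r′ , leaves-node ,
      (Tube-merge (node l r′) xs ys leaves-node (subst (Tube Γ) leaves-t tube)
      , Admissible-map l adm-l , adm-r′)
      where
        leaves-node : leaves l ++ leaves r′ ≡ (leaves l ++ k) ++ b ∷ ys
        leaves-node = trans (cong (leaves l ++_) leaves-r′) (sym (++-assoc (leaves l) k (b ∷ ys)))
    merge-adjacent-leaves (node l r) xs ys (_ , adm-l , adm-r) _
        | inj₂ ([] , leaves-l , b∷ys≡r) =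
      merge-straddling-leaves l r xs ys adm-l adm-r leaves-l (sym b∷ys≡r)
    merge-adjacent-leaves (node l r) xs _ (tube , adm-l , adm-r) leaves-t
        | inj₂ (_ ∷ k , leaves-l , e) with ∷-injective e
    ... | refl , refl with merge-adjacent-leaves l xs k adm-l leaves-l
    ...   | l′ , leaves-l′ , adm-l′ =
      node l′ r , leaves-node ,
      (Tube-merge (node l′ r) xs (k ++ leaves r) leaves-node (subst (Tube Γ) leaves-t tube)
      , adm-l′ , Admissible-map r adm-r)
      where
        leaves-node : leaves l′ ++ leaves r ≡ xs ++ b ∷ k ++ leaves r
        leaves-node = trans (cong (_++ leaves r) leaves-l′) (++-assoc xs (b ∷ k) (leaves r))

module Contraction (Γ : Graph) (G : List (V Γ)) where

  private
    T-stable : ∀ c → ¬ T (not c) → T c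
    T-stable true  _    = tt
    T-stable false ¬not = ⊥-elim (¬not tt)

    T-not-¬ : ∀ c → T c → ¬ T (not c)
    T-not-¬ true _ ()

  memb⇒∈ : ∀ {v} H → T (memb Γ v H) → v ∈ H
  memb⇒∈ {v} (g ∷ H) m with _≟V_ Γ v g
  ... | yes v≡g = here v≡g
  ... | no  _   = there (memb⇒∈ H m)

  ∈⇒memb : ∀ {v} H → v ∈ H → T (memb Γ v H)
  ∈⇒memb {v} (g ∷ H) v∈ with _≟V_ Γ v g | v∈
  ... | yes _   | _         = tt
  ... | no  v≢g | here v≡g  = ⊥-elim (v≢g v≡g)
  ... | no  _   | there v∈H = ∈⇒memb H v∈H

  contract : V Γ → V (Γ / G)
  contract v with T? (not (memb Γ v G))
  ... | yes v∉G = inj₁ (v , v∉G)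
  ... | no  _   = inj₂ tt

  contract-cases : ∀ v → (v ∈ G × contract v ≡ inj₂ tt)
                       ⊎ Σ (T (not (memb Γ v G))) (λ v∉G → contract v ≡ inj₁ (v , v∉G))
  contract-cases v with T? (not (memb Γ v G))
  ... | yes v∉G = inj₂ (v∉G , refl)
  ... | no  ¬v∉G = inj₁ (memb⇒∈ G (T-stable _ ¬v∉G) , refl)

  contract-∈ : ∀ {v} → v ∈ G → contract v ≡ inj₂ tt
  contract-∈ {v} v∈G with contract-cases v
  ... | inj₁ (_ , e)   = e
  ... | inj₂ (v∉G , _) = ⊥-elim (T-not-¬ _ (∈⇒memb G v∈G) v∉G)

  contract-∉ : ∀ {v} (v∉G : T (not (memb Γ v G))) → contract v ≡ inj₁ (v , v∉G)
  contract-∉ {v} v∉G with contract-cases v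
  ... | inj₁ (v∈G , _)  = ⊥-elim (T-not-¬ _ (∈⇒memb G v∈G) v∉G)
  ... | inj₂ (v∉G′ , e) = trans e (cong (λ p → inj₁ (v , p)) (T-irrelevant v∉G′ v∉G))

  contract-weakHomomorphism : WeakHomomorphism Γ (Γ / G) contract
  contract-weakHomomorphism {u} {w} uw with contract-cases u | contract-cases w
  ... | inj₁ (_ , eu)   | inj₁ (_ , ew)   = inj₁ (trans eu (sym ew))
  ... | inj₁ (u∈G , eu) | inj₂ (_ , ew)   rewrite eu | ew = inj₂ (u , u∈G , uw)
  ... | inj₂ (_ , eu)   | inj₁ (w∈G , ew) rewrite eu | ew = inj₂ (w , w∈G , uw)
  ... | inj₂ (_ , eu)   | inj₂ (_ , ew)   rewrite eu | ew = inj₂ uw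

  contract-surjective : ∀ {g} → g ∈ G → ∀ y → ∃ λ v → contract v ≡ y
  contract-surjective {g} g∈G (inj₁ (v , v∉G)) = v , contract-∉ v∉G
  contract-surjective {g} g∈G (inj₂ tt)        = g , contract-∈ g∈G

  map-orig-contract : ∀ {vs} → All (_∉ G) vs → map (orig Γ G) (map contract vs) ≡ map just vs
  map-orig-contract []               = refl
  map-orig-contract {v ∷ _} (v∉G ∷ vs∉G) = cong₂ _∷_ orig-contract (map-orig-contract vs∉G)
    where
      orig-contract : orig Γ G (contract v) ≡ just v
      orig-contract with contract-cases v
      ... | inj₁ (v∈G , _) = ⊥-elim (v∉G v∈G)
      ... | inj₂ (_ , e)   = cong (orig Γ G) e

module EdgeContraction (Γ : Graph) {a b : V Γ} where

  open Contraction Γ (a ∷ b ∷ []) public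
  open WeakHomomorphism {Γ} {Γ / (a ∷ b ∷ [])} {contract} contract-weakHomomorphism

  contract-a≡b : contract a ≡ contract b
  contract-a≡b = trans (contract-∈ (here refl)) (sym (contract-∈ (there (here refl))))

  module _ (xs ys : List (V Γ)) where

    orig-merged-labels : Unique (xs ++ a ∷ b ∷ ys) →
      map (orig Γ (a ∷ b ∷ [])) (map contract (xs ++ b ∷ ys)) ≡ map just xs ++ nothing ∷ map just ys
    orig-merged-labels uq = begin
      map orig′ (map contract (xs ++ b ∷ ys))
        ≡⟨ cong (map orig′) (map-++ contract xs (b ∷ ys)) ⟩
      map orig′ (map contract xs ++ contract b ∷ map contract ys)
        ≡⟨ map-++ orig′ (map contract xs) (contract b ∷ map contract ys) ⟩
      map orig′ (map contract xs) ++ orig′ (contract b) ∷ map orig′ (map contract ys)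
        ≡⟨ cong₂ _++_ (map-orig-contract xs∉G)
             (cong₂ _∷_ (cong orig′ (contract-∈ (there (here refl)))) (map-orig-contract ys∉G)) ⟩
      map just xs ++ nothing ∷ map just ys ∎
      where
        open ≡-Reasoning
        orig′ = orig Γ (a ∷ b ∷ [])
        avoid = Unique-++-∷-∷ xs ys uq .proj₁
        xs∉G = Allₚ.++⁻ˡ xs avoid
        ys∉G = Allₚ.++⁻ʳ xs avoid

    merged-labels-unique : Unique (xs ++ a ∷ b ∷ ys) → Unique (map contract (xs ++ b ∷ ys))
    merged-labels-unique uq =
      Unique.map⁻ {f = orig Γ (a ∷ b ∷ [])} (subst Unique (sym (orig-merged-labels uq))
        (Unique-just-nothing xs ys (Unique-++-∷-∷ xs ys uq .proj₂)))

    merged-labels-cover : (∀ v → v ∈ xs ++ a ∷ b ∷ ys) → ∀ y → y ∈ map contract (xs ++ b ∷ ys)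
    merged-labels-cover cover y with contract-surjective (here refl) y
    ... | v , refl = map-merge-⊆ contract xs ys contract-a≡b (∈-map⁺ contract (cover v))

    merged-leaf-seq : E Γ a b → IsAdmissibleLeafSeq Γ (xs ++ a ∷ b ∷ ys) →
                      IsAdmissibleLeafSeq (Γ / (a ∷ b ∷ [])) (map contract (xs ++ b ∷ ys))
    merged-leaf-seq ab σ@(t , adm , _ , leaves-t)
      with merge-adjacent-leaves ab contract-a≡b t xs ys adm leaves-t
    ... | t′ , leaves-t′ , adm′ =
      AdmissibleLeafSeq-intro (Γ / (a ∷ b ∷ [])) (mapPTree contract t′) adm′
        (merged-labels-unique (AdmissibleLeafSeq⇒Unique Γ σ))
        (merged-labels-cover (AdmissibleLeafSeq⇒covers Γ σ))
        (trans (leaves-mapPTree contract t′) (cong (map contract) leaves-t′))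

lemma2p4p2 : (Γ : Graph) → Connected Γ →
    (xs ys : List (V Γ)) (a b : V Γ) →
    IsAdmissibleLeafSeq Γ (xs ++ a ∷ b ∷ ys) →
    E Γ a b →
    ∃ λ (σi : List (V (_/_ Γ (a ∷ b ∷ [])))) →
    IsAdmissibleLeafSeq (_/_ Γ (a ∷ b ∷ [])) σi ×
    map (orig Γ (a ∷ b ∷ [])) σi ≡ map just xs ++ nothing ∷ map just ys
lemma2p4p2 Γ _ xs ys a b σ ab =
  map contract (xs ++ b ∷ ys) ,
  merged-leaf-seq xs ys ab σ ,
  orig-merged-labels xs ys (AdmissibleLeafSeq⇒Unique Γ σ)
  where open EdgeContraction Γ {a} {b}
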